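{- Let $\mathbf{C}$ be a quasitopos and $\rho$ a canonical PBPO rule. Then $$\Rightarrow^{\rho}_{\mathrm{PBPO}^{\hookrightarrow}}\;=\;\bigcup_{\tau\in\mathrm{compact}^{\cong}(\rho)}\Rightarrow^{\tau}_{\mathrm{PBPO}^+}.$$
   Context: A quasitopos is a category with all finite limits and colimits that is locally cartesian closed and has a regular-subobject classifier. PBPO rule $\rho$: spans $L\xleftarrow{l}K\xrightarrow{r}R$ and $L'\xleftarrow{l'}K'\xrightarrow{r'}R'$ with $t_L:L\to L'$, $t_K:K\to K'$, $t_R:R\to R'$, $t_Ll=l't_K$, $t_Rr=r't_K$; canonical if the left square is a pullback and the right square a pushout. PBPO step with $m:L\to G_L$, $\alpha:G_L\to L'$: $t_L=\alpha m$, $G_L\xleftarrow{g_L}G_K\xrightarrow{u'}K'$ a pullback of $\alpha,l'$, $u:K\to G_K$ induced with $g_Lu=ml$, $u'u=t_K$, and $G_R$ a pushout of $G_K\xleftarrow{u}K\xrightarrow{r}R$. $G_L\Rightarrow^{\rho}_{\mathrm{PBPO}^{\hookrightarrow}}G_R$ if such a step exists with $m$ a regular monomorphism. PBPO$^+$ rule $\tau$: $l:K\to L$, $r:K\to R$, $t_L:L\to L'$, $t_K:K\to K'$, $l':K'\to L'$ with $t_Ll=l't_K$ a pullback. PBPO$^+$ step with $m,\alpha$: $\alpha m=t_L$ and $L\xleftarrow{1_L}L\xrightarrow{m}G_L$ a pullback of $t_L,\alpha$; $G_K$ a pullback of $\alpha,l'$; $u$ the unique morphism with $u'u=t_K$;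 $G_R$ a pushout of $u,r$. rm-materialization of $f:A\to B$: a factorization $A\xrightarrow{f'}F\xrightarrow{f''}B$ with $f'$ a regular mono such that for every factorization $A\xrightarrow{m}C\xrightarrow{\alpha}B$ of $f$ with $m$ a regular mono there is a unique $\beta:C\to F$ with $f''\beta=\alpha$ and the square $\beta\circ m=f'\circ 1_A$ a pullback (these exist in a quasitopos). Compacted rule: for canonical $\rho$ and a factorization $t_L=f\circ e$ with $e:L\to L_e$ epic, let $L_e\xrightarrow{f'}F\xrightarrow{f''}L'$ be the rm-materialization of $f$; $F\xleftarrow{p}F'\xrightarrow{q}K'$ a pullback of $f'',l'$; $L_e\xleftarrow{l_e}K_e\xrightarrow{k}F'$ a pullback of $f',p$; $j:K\to K_e$ the induced morphism (from $e\circ l$ and the morphism $K\to F'$ induced by $f'el$ and $t_K$); $K_e\xrightarrow{r_e}R_e\leftarrow R$ a pushout of $K_e\xleftarrow{j}K\xrightarrow{r}R$. Then $\rho_e$ is the PBPO$^+$ rule with $l=l_e$, $r=r_e$, $t_L=f'$, $t_K=k$, $l'=p$. $\mathrm{compact}^{\cong}(\rho)=\{\rho_e\mid t_L=f\circ e,\ e\text{ an isomorphism}\}$. -}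

module Defs where

open import Level using (Level; _⊔_; suc)
open import Data.Product using (Σ; _×_; _,_; Σ-syntax)
open import Relation.Binary using (IsEquivalence)

record Category (o m e : Level) : Set (suc (o ⊔ m ⊔ e)) where
  infixr 9 _∘_
  infix 4 _≈_
  field
    Obj   : Set o
    Hom   : Obj → Obj → Set m
    _≈_   : ∀ {A B} → Hom A B → Hom A B → Set e
    id    : ∀ {A} → Hom A A
    _∘_   : ∀ {A B C} → Hom B C → Hom A B → Hom A C
    equiv : ∀ {A B} → IsEquivalence (_≈_ {A} {B})
    ∘-resp-≈ : ∀ {A B C} {f h : Hom B C} {g i : Hom A B} → f ≈ h → g ≈ i → f ∘ g ≈ h ∘ i
    assoc : ∀ {A B C D} {f : Hom A B} {g : Hom B C} {h : Hom C D} → (h ∘ g) ∘ f ≈ h ∘ (g ∘ f)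
    identityˡ : ∀ {A B} {f : Hom A B} → id ∘ f ≈ f
    identityʳ : ∀ {A B} {f : Hom A B} → f ∘ id ≈ f

module _ {o m e} (𝒞 : Category o m e) where
  open Category 𝒞

  ∃!Hom : ∀ {ℓ} {A B : Obj} → (Hom A B → Set ℓ) → Set (m ⊔ e ⊔ ℓ)
  ∃!Hom {A = A} {B} P = Σ[ u ∈ Hom A B ] (P u × (∀ v → P v → v ≈ u))

  IsIso : ∀ {A B} → Hom A B → Set (m ⊔ e)
  IsIso {A} {B} f = Σ[ g ∈ Hom B A ] (g ∘ f ≈ id × f ∘ g ≈ id)

  IsEpi : ∀ {A B} → Hom A B → Set (o ⊔ m ⊔ e)
  IsEpi {A} {B} f = ∀ {C} (g h : Hom B C) → g ∘ f ≈ h ∘ f → g ≈ h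

  IsEqualizer : ∀ {E X Y} → Hom E X → Hom X Y → Hom X Y → Set (o ⊔ m ⊔ e)
  IsEqualizer {E} {X} {Y} mm f g =
    (f ∘ mm ≈ g ∘ mm) ×
    (∀ {Z} (h : Hom Z X) → f ∘ h ≈ g ∘ h → ∃!Hom {A = Z} {B = E} (λ k → mm ∘ k ≈ h))

  IsRegularMono : ∀ {E X} → Hom E X → Set (o ⊔ m ⊔ e)
  IsRegularMono {E} {X} mm = Σ[ Y ∈ Obj ] Σ[ f ∈ Hom X Y ] Σ[ g ∈ Hom X Y ] IsEqualizer mm f g

  IsPullback : ∀ {A B C P} → Hom A C → Hom B C → Hom P A → Hom P B → Set (o ⊔ m ⊔ e)
  IsPullback {A} {B} {C} {P} f g p₁ p₂ =
    (f ∘ p₁ ≈ g ∘ p₂) ×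
    (∀ {Q} (h₁ : Hom Q A) (h₂ : Hom Q B) → f ∘ h₁ ≈ g ∘ h₂ →
       ∃!Hom {A = Q} {B = P} (λ u → (p₁ ∘ u ≈ h₁) × (p₂ ∘ u ≈ h₂)))

  IsPushout : ∀ {A B C P} → Hom C A → Hom C B → Hom A P → Hom B P → Set (o ⊔ m ⊔ e)
  IsPushout {A} {B} {C} {P} f g i₁ i₂ =
    (i₁ ∘ f ≈ i₂ ∘ g) ×
    (∀ {Q} (h₁ : Hom A Q) (h₂ : Hom B Q) → h₁ ∘ f ≈ h₂ ∘ g →
       ∃!Hom {A = P} {B = Q} (λ u → (u ∘ i₁ ≈ h₁) × (u ∘ i₂ ≈ h₂)))

  IsTerminal : Obj → Set (o ⊔ m ⊔ e)
  IsTerminal T = ∀ X → Σ[ u ∈ Hom X T ] (∀ v → v ≈ u)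

  IsInitial : Obj → Set (o ⊔ m ⊔ e)
  IsInitial I = ∀ X → Σ[ u ∈ Hom I X ] (∀ v → v ≈ u)

  -- Locally cartesian closed: for every f : A → B, the pullback functor
  -- f* : C/B → C/A has a right adjoint Π_f, given by a couniversal arrow
  -- (Π_f p, ev) for every object p : X → A of C/A.
  HasDependentProducts : Set (o ⊔ m ⊔ e)
  HasDependentProducts =
    ∀ {A B X} (f : Hom A B) (p : Hom X A) →
    Σ[ Y ∈ Obj ] Σ[ q ∈ Hom Y B ] Σ[ P ∈ Obj ] Σ[ π₁ ∈ Hom P Y ] Σ[ π₂ ∈ Hom P A ]
    Σ[ ev ∈ Hom P X ]
      (IsPullback q f π₁ π₂ × (p ∘ ev ≈ π₂) ×
       (∀ {Z Q} (z : Hom Z B) (σ₁ : Hom Q Z) (σ₂ : Hom Q A) → IsPullback z f σ₁ σ₂ →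
        (k : Hom Q X) → p ∘ k ≈ σ₂ →
        ∃!Hom {A = Z} {B = Y} (λ k' → (q ∘ k' ≈ z) ×
          (∀ (w : Hom Q P) → π₁ ∘ w ≈ k' ∘ σ₁ → π₂ ∘ w ≈ σ₂ → ev ∘ w ≈ k))))

  record IsQuasitopos : Set (o ⊔ m ⊔ e) where
    field
      𝟙 : Obj
      𝟙-terminal : IsTerminal 𝟙
      pullback : ∀ {A B C} (f : Hom A C) (g : Hom B C) →
        Σ[ P ∈ Obj ] Σ[ p₁ ∈ Hom P A ] Σ[ p₂ ∈ Hom P B ] IsPullback f g p₁ p₂
      𝟘 : Obj
      𝟘-initial : IsInitial 𝟘
      pushout : ∀ {A B C} (f : Hom C A) (g : Hom C B) →
        Σ[ P ∈ Obj ] Σ[ i₁ ∈ Hom A P ] Σ[ i₂ ∈ Hom B P ] IsPushout f g i₁ i₂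
      lcc : HasDependentProducts
      Ω : Obj
      true : Hom 𝟙 Ω
      true-regular : IsRegularMono true
      classify : ∀ {A X} (mm : Hom A X) → IsRegularMono mm →
        ∃!Hom {A = X} {B = Ω} (λ χ → IsPullback χ true mm (Data.Product.proj₁ (𝟙-terminal A)))

  record PBPORule : Set (o ⊔ m ⊔ e) where
    field
      L K R L' K' R' : Obj
      l  : Hom K L
      r  : Hom K R
      l' : Hom K' L'
      r' : Hom K' R'
      tL : Hom L L'
      tK : Hom K K'
      tR : Hom R R'
      commL : tL ∘ l ≈ l' ∘ tK
      commR : tR ∘ r ≈ r' ∘ tK

  IsCanonical : PBPORule → Set (o ⊔ m ⊔ e)
  IsCanonical ρ = IsPullback tL l' l tK × IsPushout tK r r' tR
    where open PBPORule ρ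

  PBPO↪Step : PBPORule → Obj → Obj → Set (o ⊔ m ⊔ e)
  PBPO↪Step ρ GL GR =
    Σ[ mm ∈ Hom L GL ] Σ[ α ∈ Hom GL L' ]
    Σ[ GK ∈ Obj ] Σ[ gL ∈ Hom GK GL ] Σ[ u' ∈ Hom GK K' ] Σ[ u ∈ Hom K GK ]
    Σ[ gR ∈ Hom GK GR ] Σ[ wR ∈ Hom R GR ]
      ( IsRegularMono mm
      × (tL ≈ α ∘ mm)
      × IsPullback α l' gL u'
      × (gL ∘ u ≈ mm ∘ l) × (u' ∘ u ≈ tK)
      × IsPushout u r gR wR )
    where open PBPORule ρ

  record PBPO⁺Rule : Set (o ⊔ m ⊔ e) where
    field
      L K R L' K' : Obj
      l  : Hom K L
      r  : Hom K R
      tL : Hom L L'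
      tK : Hom K K'
      l' : Hom K' L'
      pb : IsPullback tL l' l tK

  PBPO⁺Step : PBPO⁺Rule → Obj → Obj → Set (o ⊔ m ⊔ e)
  PBPO⁺Step τ GL GR =
    Σ[ mm ∈ Hom L GL ] Σ[ α ∈ Hom GL L' ]
    Σ[ GK ∈ Obj ] Σ[ gL ∈ Hom GK GL ] Σ[ u' ∈ Hom GK K' ] Σ[ u ∈ Hom K GK ]
    Σ[ gR ∈ Hom GK GR ] Σ[ wR ∈ Hom R GR ]
      ( (α ∘ mm ≈ tL)
      × IsPullback tL α id mm
      × IsPullback α l' gL u'
      × ((u' ∘ u ≈ tK) × (∀ v → u' ∘ v ≈ tK → v ≈ u))
      × IsPushout u r gR wR )
    where open PBPO⁺Rule τ

  IsRmMaterialization : ∀ {A B F} → Hom A B → Hom A F → Hom F B → Set (o ⊔ m ⊔ e)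
  IsRmMaterialization {A} {B} {F} f f' f'' =
    (f'' ∘ f' ≈ f) × IsRegularMono f' ×
    (∀ {C} (mm : Hom A C) (α : Hom C B) → IsRegularMono mm → α ∘ mm ≈ f →
      ∃!Hom {A = C} {B = F} (λ β → (f'' ∘ β ≈ α) × IsPullback β f' mm id))

  -- Compacted rules: all data (chosen up to the universal properties)
  -- determining a rule ρ_e for a factorization t_L = f ∘ e.

  record CompactionData (ρ : PBPORule) : Set (o ⊔ m ⊔ e) where
    open PBPORule ρ
    field
      Le : Obj
      eL : Hom L Le
      f  : Hom Le L'
      fact : tL ≈ f ∘ eL
      F   : Obj
      f'  : Hom Le F
      f'' : Hom F L'
      rm  : IsRmMaterialization f f' f''
      F'  : Obj
      p   : Hom F' F
      q   : Hom F' K'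
      pb₁ : IsPullback f'' l' p q
      Ke  : Obj
      le  : Hom Ke Le
      k   : Hom Ke F'
      pb₂ : IsPullback f' p le k
      h   : Hom K F'
      h-p : p ∘ h ≈ f' ∘ (eL ∘ l)
      h-q : q ∘ h ≈ tK
      j   : Hom K Ke
      j-le : le ∘ j ≈ eL ∘ l
      j-k  : k ∘ j ≈ h
      Re  : Obj
      re  : Hom Ke Re
      wRe : Hom R Re
      po  : IsPushout j r re wRe

  compactRule : ∀ {ρ} → CompactionData ρ → PBPO⁺Rule
  compactRule c = record
    { L = Le ; K = Ke ; R = Re ; L' = F ; K' = F'
    ; l = le ; r = re ; tL = f' ; tK = k ; l' = p ; pb = pb₂ }
    where open CompactionData c

  -- τ ∈ compact^≅(ρ): compaction data whose epimorphism e is an isomorphism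
  InCompact≅ : (ρ : PBPORule) → CompactionData ρ → Set (m ⊔ e)
  InCompact≅ ρ c = IsIso (CompactionData.eL c)

-- (⇒) Take e = id. The compacted rule then has the rm-materialization L → F → L' of t_L
-- as its type morphism, and a regular-mono match m with t_L = α m factors α uniquely as
-- f'' β with m the pullback of f' along β, which is exactly a PBPO⁺ match; the squares
-- over F' → F are obtained by pasting and unpasting pullbacks.
-- (⇐) A PBPO⁺ match m' is a pullback of the regular mono f', hence regular, and so is
-- m' e for the isomorphism e; gluing the PBPO⁺ squares to those of the compaction gives
-- a PBPO step for α = f'' α'. This direction holds in any category.

module Submission where

open import Defs
open import Level using (Level; _⊔_)
open import Data.Product using (_×_; Σ-syntax; _,_; proj₁; proj₂)
open import Function.Bundles using (_⇔_; mk⇔)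
open import Relation.Binary using (IsEquivalence)

module CategoryProperties {o ℓ e : Level} (𝒞 : Category o ℓ e) where
  open Category 𝒞

  module ≈ {A B : Obj} = IsEquivalence (equiv {A} {B})

  infixr 5 _○_
  _○_ : ∀ {A B} {f g h : Hom A B} → f ≈ g → g ≈ h → f ≈ h
  _○_ = ≈.trans

  infixr 6 _⟩∘⟨_
  _⟩∘⟨_ : ∀ {A B C} {f h : Hom B C} {g i : Hom A B} → f ≈ h → g ≈ i → f ∘ g ≈ h ∘ i
  _⟩∘⟨_ = ∘-resp-≈

  refl⟩∘⟨_ : ∀ {A B C} {f : Hom B C} {g i : Hom A B} → g ≈ i → f ∘ g ≈ f ∘ i
  refl⟩∘⟨ p = ≈.refl ⟩∘⟨ p

  _⟩∘⟨refl : ∀ {A B C} {f h : Hom B C} {g : Hom A B} → f ≈ h → f ∘ g ≈ h ∘ g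
  p ⟩∘⟨refl = p ⟩∘⟨ ≈.refl

  sym-assoc : ∀ {A B C D} {f : Hom A B} {g : Hom B C} {h : Hom C D} → h ∘ (g ∘ f) ≈ (h ∘ g) ∘ f
  sym-assoc = ≈.sym assoc

  pullˡ : ∀ {W X Y Z} {a : Hom Y Z} {b : Hom X Y} {c : Hom X Z} {f : Hom W X} →
    a ∘ b ≈ c → a ∘ (b ∘ f) ≈ c ∘ f
  pullˡ p = sym-assoc ○ p ⟩∘⟨refl

  pullʳ : ∀ {W X Y Z} {a : Hom Y Z} {b : Hom X Y} {f : Hom W X} {d : Hom W Y} →
    b ∘ f ≈ d → (a ∘ b) ∘ f ≈ a ∘ d
  pullʳ p = assoc ○ refl⟩∘⟨ p

  IsMono : ∀ {A B} → Hom A B → Set (o ⊔ ℓ ⊔ e)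
  IsMono {A} f = ∀ {Z} {x y : Hom Z A} → f ∘ x ≈ f ∘ y → x ≈ y

  HasPullbacks : Set (o ⊔ ℓ ⊔ e)
  HasPullbacks = ∀ {A B C} (f : Hom A C) (g : Hom B C) →
    Σ[ P ∈ Obj ] Σ[ p₁ ∈ Hom P A ] Σ[ p₂ ∈ Hom P B ] IsPullback 𝒞 f g p₁ p₂

  RmMaterialization : ∀ {A B} → Hom A B → Set (o ⊔ ℓ ⊔ e)
  RmMaterialization {A} {B} f =
    Σ[ F ∈ Obj ] Σ[ f' ∈ Hom A F ] Σ[ f'' ∈ Hom F B ] IsRmMaterialization 𝒞 f f' f''

  module _ {A B C P : Obj} {f : Hom A C} {g : Hom B C} {p₁ : Hom P A} {p₂ : Hom P B} where

    pullback-jointly-monic : IsPullback 𝒞 f g p₁ p₂ →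
      ∀ {Q} {a b : Hom Q P} → p₁ ∘ a ≈ p₁ ∘ b → p₂ ∘ a ≈ p₂ ∘ b → a ≈ b
    pullback-jointly-monic (commutes , universal) {a = a} {b} e₁ e₂ =
      let (_ , _ , unique) = universal (p₁ ∘ b) (p₂ ∘ b) (pullˡ commutes ○ assoc)
      in unique a (e₁ , e₂) ○ ≈.sym (unique b (≈.refl , ≈.refl))

    pullback-swap : IsPullback 𝒞 f g p₁ p₂ → IsPullback 𝒞 g f p₂ p₁
    pullback-swap (commutes , universal) = ≈.sym commutes , λ h₁ h₂ eq →
      let (u , (u₁ , u₂) , unique) = universal h₂ h₁ (≈.sym eq)
      in u , (u₂ , u₁) , λ v (v₁ , v₂) → unique v (v₂ , v₁)

    pullback-resp-≈ : ∀ {f₂ : Hom A C} {g₂ : Hom B C} {q₁ : Hom P A} {q₂ : Hom P B} →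
      f ≈ f₂ → g ≈ g₂ → p₁ ≈ q₁ → p₂ ≈ q₂ → IsPullback 𝒞 f g p₁ p₂ → IsPullback 𝒞 f₂ g₂ q₁ q₂
    pullback-resp-≈ ef eg e₁ e₂ (commutes , universal) =
      (≈.sym ef ⟩∘⟨ ≈.sym e₁) ○ commutes ○ (eg ⟩∘⟨ e₂) , λ h₁ h₂ eq →
        let (u , (u₁ , u₂) , unique) = universal h₁ h₂ (ef ⟩∘⟨refl ○ eq ○ ≈.sym eg ⟩∘⟨refl)
        in u , (≈.sym e₁ ⟩∘⟨refl ○ u₁ , ≈.sym e₂ ⟩∘⟨refl ○ u₂) ,
           λ v (v₁ , v₂) → unique v (e₁ ⟩∘⟨refl ○ v₁ , e₂ ⟩∘⟨refl ○ v₂)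

    pullback-∘-iso : ∀ {P'} {i : Hom P' P} → IsIso 𝒞 i → IsPullback 𝒞 f g p₁ p₂ →
      IsPullback 𝒞 f g (p₁ ∘ i) (p₂ ∘ i)
    pullback-∘-iso {i = i} (i⁻¹ , i⁻¹∘i≈id , i∘i⁻¹≈id) pb@(commutes , universal) =
      pullˡ commutes ○ assoc , λ h₁ h₂ eq →
        let (u , (u₁ , u₂) , _) = universal h₁ h₂ eq
            cancel : ∀ {X} {p : Hom P X} → (p ∘ i) ∘ (i⁻¹ ∘ u) ≈ p ∘ u
            cancel = assoc ○ refl⟩∘⟨ (pullˡ i∘i⁻¹≈id ○ identityˡ)
        in i⁻¹ ∘ u , (cancel ○ u₁ , cancel ○ u₂) , λ v (v₁ , v₂) →
           let i∘v≈u = pullback-jointly-monic pb (sym-assoc ○ v₁ ○ ≈.sym u₁)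
                                                (sym-assoc ○ v₂ ○ ≈.sym u₂)
           in ≈.sym (pullˡ i⁻¹∘i≈id ○ identityˡ) ○ refl⟩∘⟨ i∘v≈u

  pullback-glue : ∀ {X Y F F' K' L'} {a : Hom X F} {p : Hom F' F} {x : Hom Y X} {w : Hom Y F'}
    {f : Hom F L'} {l : Hom K' L'} {q : Hom F' K'} →
    IsPullback 𝒞 a p x w → IsPullback 𝒞 f l p q → IsPullback 𝒞 (f ∘ a) l x (q ∘ w)
  pullback-glue {a = a} {p} {x} {w} {f} {l} {q} (c₁ , U₁) (c₂ , U₂) =
    pullʳ c₁ ○ pullˡ c₂ ○ assoc , λ h₁ h₂ eq →
      let (t , (t₁ , t₂) , t-unique) = U₂ (a ∘ h₁) h₂ (sym-assoc ○ eq)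
          (u , (u₁ , u₂) , u-unique) = U₁ h₁ t (≈.sym t₁)
      in u , (u₁ , pullʳ u₂ ○ t₂) , λ v (v₁ , v₂) →
         u-unique v (v₁ , t-unique (w ∘ v) (pullˡ (≈.sym c₁) ○ assoc ○ refl⟩∘⟨ v₁ , sym-assoc ○ v₂))

  pullback-unglue : ∀ {X Y F F' K' L'} {a : Hom X F} {p : Hom F' F} {x : Hom Y X} {w : Hom Y F'}
    {f : Hom F L'} {l : Hom K' L'} {q : Hom F' K'} →
    a ∘ x ≈ p ∘ w → IsPullback 𝒞 (f ∘ a) l x (q ∘ w) → IsPullback 𝒞 f l p q → IsPullback 𝒞 a p x w
  pullback-unglue {a = a} {p} {x} {w} {f} {l} {q} c (_ , U) right@(c₂ , _) =
    c , λ h₁ h₂ eq →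
      let (u , (u₁ , u₂) , unique) = U h₁ (q ∘ h₂) (assoc ○ refl⟩∘⟨ eq ○ pullˡ c₂ ○ assoc)
      in u , (u₁ , pullback-jointly-monic right (pullˡ (≈.sym c) ○ assoc ○ refl⟩∘⟨ u₁ ○ eq)
                                                 (sym-assoc ○ u₂)) ,
         λ v (v₁ , v₂) → unique v (v₁ , pullʳ v₂)

  pullback-id-factor : ∀ {A B C} {f : Hom A C} {g : Hom B C} {p : Hom B A} →
    IsPullback 𝒞 f g p id → ∀ {Q} {y : Hom Q A} {z : Hom Q B} → f ∘ y ≈ g ∘ z → y ≈ p ∘ z
  pullback-id-factor (_ , universal) eq =
    let (u , (u₁ , u₂) , _) = universal _ _ eq
    in ≈.sym u₁ ○ refl⟩∘⟨ (≈.sym identityˡ ○ u₂)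

  mono⇒pullback-id : ∀ {A B C} {g : Hom B C} {x : Hom A C} {y : Hom A B} →
    IsMono g → x ≈ g ∘ y → IsPullback 𝒞 x g id y
  mono⇒pullback-id g-mono x≈gy =
    identityʳ ○ x≈gy , λ h₁ h₂ eq →
      h₁ , (identityˡ , g-mono (sym-assoc ○ ≈.sym x≈gy ⟩∘⟨refl ○ eq)) ,
      λ v (v₁ , _) → ≈.sym identityˡ ○ v₁

  regularMono⇒mono : ∀ {A B} {f : Hom A B} → IsRegularMono 𝒞 f → IsMono f
  regularMono⇒mono {f = f} (_ , _ , _ , commutes , universal) {y = y} eq =
    let (_ , _ , unique) = universal (f ∘ y) (pullˡ commutes ○ assoc)
    in unique _ eq ○ ≈.sym (unique y ≈.refl)

  id-regularMono : ∀ {A} → IsRegularMono 𝒞 (id {A})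
  id-regularMono {A} = A , id , id , ≈.refl , λ h _ →
    h , identityˡ , λ v v≈h → ≈.sym identityˡ ○ v≈h

  split-mono⇒regularMono : ∀ {A B} {s : Hom A B} {r : Hom B A} → r ∘ s ≈ id → IsRegularMono 𝒞 s
  split-mono⇒regularMono {B = B} {s} {r} r∘s≈id =
    B , id , s ∘ r , identityˡ ○ ≈.sym (pullʳ r∘s≈id ○ identityʳ) , λ h eq →
      r ∘ h , ≈.sym (≈.sym identityˡ ○ eq ○ assoc) , λ v s∘v≈h →
        ≈.sym (pullˡ r∘s≈id ○ identityˡ) ○ refl⟩∘⟨ s∘v≈h

  regularMono-∘-iso : ∀ {A A' B} {f : Hom A B} {i : Hom A' A} →
    IsRegularMono 𝒞 f → IsIso 𝒞 i → IsRegularMono 𝒞 (f ∘ i)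
  regularMono-∘-iso {f = f} {i} f-regular@(Y , a , b , commutes , universal)
    (i⁻¹ , i⁻¹∘i≈id , i∘i⁻¹≈id) =
    Y , a , b , pullˡ commutes ○ assoc , λ h eq →
      let (k , f∘k≈h , _) = universal h eq
      in i⁻¹ ∘ k , pullʳ (pullˡ i∘i⁻¹≈id ○ identityˡ) ○ f∘k≈h , λ v fi∘v≈h →
         ≈.sym (pullˡ i⁻¹∘i≈id ○ identityˡ)
         ○ refl⟩∘⟨ regularMono⇒mono f-regular (sym-assoc ○ fi∘v≈h ○ ≈.sym f∘k≈h)

  pullback-of-regularMono : ∀ {A B C P} {f : Hom A C} {g : Hom B C} {p₁ : Hom P A} {p₂ : Hom P B} →
    IsRegularMono 𝒞 g → IsPullback 𝒞 f g p₁ p₂ → IsRegularMono 𝒞 p₁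
  pullback-of-regularMono {C = C} {f = f} {g = g} {p₁ = p₁}
    g-regular@(Y , a , b , commutes , universal) pb@(square , pb-universal) =
    Y , a ∘ f , b ∘ f , lift commutes , λ h eq →
      let (k , g∘k≈f∘h , _) = universal (f ∘ h) (sym-assoc ○ eq ○ assoc)
          (u , (u₁ , _) , _) = pb-universal h k (≈.sym g∘k≈f∘h)
      in u , u₁ , λ v p₁∘v≈h →
         let p₁∘v≈p₁∘u = p₁∘v≈h ○ ≈.sym u₁
         in pullback-jointly-monic pb p₁∘v≈p₁∘u (regularMono⇒mono g-regular
              (sym-assoc ○ ≈.sym square ⟩∘⟨refl ○ assoc ○ refl⟩∘⟨ p₁∘v≈p₁∘u
               ○ sym-assoc ○ square ⟩∘⟨refl ○ assoc))
    where
    lift : ∀ {a b : Hom C Y} → a ∘ g ≈ b ∘ g → (a ∘ f) ∘ p₁ ≈ (b ∘ f) ∘ p₁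
    lift a∘g≈b∘g = pullʳ square ○ sym-assoc ○ a∘g≈b∘g ⟩∘⟨refl ○ pullʳ (≈.sym square) ○ sym-assoc

  pushout-glue : ∀ {K Ke Re GK GR R} {j : Hom K Ke} {r : Hom K R} {re : Hom Ke Re} {wRe : Hom R Re}
    {u : Hom Ke GK} {gR : Hom GK GR} {wR : Hom Re GR} →
    IsPushout 𝒞 j r re wRe → IsPushout 𝒞 u re gR wR → IsPushout 𝒞 (u ∘ j) r gR (wR ∘ wRe)
  pushout-glue {j = j} {r} {re} {wRe} {u} {gR} {wR} (c₁ , U₁) (c₂ , U₂) =
    sym-assoc ○ c₂ ⟩∘⟨refl ○ pullʳ c₁ ○ sym-assoc , λ h₁ h₂ eq →
      let (t , (t₁ , t₂) , t-unique) = U₁ (h₁ ∘ u) h₂ (assoc ○ eq)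
          (s , (s₁ , s₂) , s-unique) = U₂ h₁ t (≈.sym t₁)
      in s , (s₁ , sym-assoc ○ s₂ ⟩∘⟨refl ○ t₂) , λ v (v₁ , v₂) →
         s-unique v (v₁ , t-unique (v ∘ wR)
           (pullʳ (≈.sym c₂) ○ sym-assoc ○ v₁ ⟩∘⟨refl , assoc ○ v₂))

  id-pushout : ∀ {K R} {r : Hom K R} → IsPushout 𝒞 id r r id
  id-pushout = identityʳ ○ ≈.sym identityˡ , λ h₁ h₂ eq →
    h₂ , (≈.sym eq ○ identityʳ , identityʳ) , λ v (_ , v₂) → ≈.sym identityʳ ○ v₂

  record DependentProduct {A B X : Obj} (f : Hom A B) (p : Hom X A) : Set (o ⊔ ℓ ⊔ e) where
    field
      Π        : Obj
      q        : Hom Π B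
      P        : Obj
      π₁       : Hom P Π
      π₂       : Hom P A
      ev       : Hom P X
      pullback : IsPullback 𝒞 q f π₁ π₂
      ev-over  : p ∘ ev ≈ π₂

    Transposes : ∀ {Z Q} → Hom Z B → Hom Q Z → Hom Q A → Hom Q X → Hom Z Π → Set (ℓ ⊔ e)
    Transposes {Q = Q} z σ₁ σ₂ k k' =
      (q ∘ k' ≈ z) × (∀ (w : Hom Q P) → π₁ ∘ w ≈ k' ∘ σ₁ → π₂ ∘ w ≈ σ₂ → ev ∘ w ≈ k)

    field
      universal : ∀ {Z Q} (z : Hom Z B) (σ₁ : Hom Q Z) (σ₂ : Hom Q A) → IsPullback 𝒞 z f σ₁ σ₂ →
        (k : Hom Q X) → p ∘ k ≈ σ₂ → ∃!Hom 𝒞 (Transposes z σ₁ σ₂ k)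

  dependentProduct : HasDependentProducts 𝒞 → ∀ {A B X} (f : Hom A B) (p : Hom X A) →
    DependentProduct f p
  dependentProduct lcc f p with lcc f p
  ... | Π , q , P , π₁ , π₂ , ev , pullback , ev-over , universal = record
    { Π = Π ; q = q ; P = P ; π₁ = π₁ ; π₂ = π₂ ; ev = ev
    ; pullback = pullback ; ev-over = ev-over ; universal = universal }

module QuasitoposMaterialization {o ℓ e : Level} (𝒞 : Category o ℓ e) (QT : IsQuasitopos 𝒞) where
  open Category 𝒞
  open IsQuasitopos QT
  open CategoryProperties 𝒞

  ! : ∀ X → Hom X 𝟙
  ! X = proj₁ (𝟙-terminal X)

  !-unique₂ : ∀ {X} {v w : Hom X 𝟙} → v ≈ w
  !-unique₂ {X} {v} {w} = proj₂ (𝟙-terminal X) v ○ ≈.sym (proj₂ (𝟙-terminal X) w)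

  module _ {A C : Obj} {m : Hom A C} (m-regular : IsRegularMono 𝒞 m) where

    χ : Hom C Ω
    χ = proj₁ (classify m m-regular)

    χ-pullback : IsPullback 𝒞 χ true m (! A)
    χ-pullback = proj₁ (proj₂ (classify m m-regular))

    χ-unique : ∀ {φ : Hom C Ω} → IsPullback 𝒞 φ true m (! A) → φ ≈ χ
    χ-unique = proj₂ (proj₂ (classify m m-regular)) _

  module Product (X Y : Obj) where
    private
      product : Σ[ P ∈ Obj ] Σ[ p₁ ∈ Hom P X ] Σ[ p₂ ∈ Hom P Y ] IsPullback 𝒞 (! X) (! Y) p₁ p₂
      product = pullback (! X) (! Y)

    X×Y : Obj
    X×Y = proj₁ product

    π₁ : Hom X×Y X
    π₁ = proj₁ (proj₂ product)

    π₂ : Hom X×Y Y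
    π₂ = proj₁ (proj₂ (proj₂ product))

    private
      isProduct : IsPullback 𝒞 (! X) (! Y) π₁ π₂
      isProduct = proj₂ (proj₂ (proj₂ product))

    ⟨_,_⟩ : ∀ {Z} → Hom Z X → Hom Z Y → Hom Z X×Y
    ⟨ a , b ⟩ = proj₁ (proj₂ isProduct a b !-unique₂)

    π₁∘⟨⟩ : ∀ {Z} {a : Hom Z X} {b : Hom Z Y} → π₁ ∘ ⟨ a , b ⟩ ≈ a
    π₁∘⟨⟩ {a = a} {b} = proj₁ (proj₁ (proj₂ (proj₂ isProduct a b !-unique₂)))

    π₂∘⟨⟩ : ∀ {Z} {a : Hom Z X} {b : Hom Z Y} → π₂ ∘ ⟨ a , b ⟩ ≈ b
    π₂∘⟨⟩ {a = a} {b} = proj₂ (proj₁ (proj₂ (proj₂ isProduct a b !-unique₂)))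

    ⟨⟩-jointly-monic : ∀ {Z} {x y : Hom Z X×Y} → π₁ ∘ x ≈ π₁ ∘ y → π₂ ∘ x ≈ π₂ ∘ y → x ≈ y
    ⟨⟩-jointly-monic = pullback-jointly-monic isProduct

  -- η = ⟨true ∘ !, id⟩ : B → Ω × B is a regular mono such that every regular-mono
  -- factorization α m = f yields a pullback square ⟨χ_m, α⟩ m = η f; the dependent
  -- product F = Π_η f therefore classifies these factorizations.
  module Materialization {A B : Obj} (f : Hom A B) where
    open Product Ω B renaming (X×Y to Ω×B; π₁ to πΩ; π₂ to πB; π₁∘⟨⟩ to πΩ∘⟨⟩; π₂∘⟨⟩ to πB∘⟨⟩)

    η : Hom B Ω×B
    η = ⟨ true ∘ ! B , id ⟩

    η-regularMono : IsRegularMono 𝒞 η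
    η-regularMono = split-mono⇒regularMono πB∘⟨⟩

    η-pullback : IsPullback 𝒞 πΩ true η (! B)
    η-pullback = πΩ∘⟨⟩ , λ h₁ h₂ eq →
      πB ∘ h₁ ,
      ( ⟨⟩-jointly-monic (pullˡ πΩ∘⟨⟩ ○ assoc ○ refl⟩∘⟨ !-unique₂ ○ ≈.sym eq)
                         (pullˡ πB∘⟨⟩ ○ identityˡ)
      , !-unique₂ ) ,
      λ v (η∘v≈h₁ , _) → ≈.sym (pullˡ πB∘⟨⟩ ○ identityˡ) ○ refl⟩∘⟨ η∘v≈h₁

    classifying-square : ∀ {C} {m : Hom A C} {α : Hom C B} (m-regular : IsRegularMono 𝒞 m) →
      α ∘ m ≈ f → IsPullback 𝒞 ⟨ χ m-regular , α ⟩ η m f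
    classifying-square {m = m} {α} m-regular α∘m≈f = pullback-unglue commutes outer η-pullback
      where
      commutes : ⟨ χ m-regular , α ⟩ ∘ m ≈ η ∘ f
      commutes = ⟨⟩-jointly-monic
        (pullˡ πΩ∘⟨⟩ ○ proj₁ (χ-pullback m-regular) ○ refl⟩∘⟨ !-unique₂
         ○ sym-assoc ○ ≈.sym πΩ∘⟨⟩ ⟩∘⟨refl ○ assoc)
        (pullˡ πB∘⟨⟩ ○ α∘m≈f ○ ≈.sym (pullˡ πB∘⟨⟩ ○ identityˡ))

      outer : IsPullback 𝒞 (πΩ ∘ ⟨ χ m-regular , α ⟩) true m (! B ∘ f)
      outer = pullback-resp-≈ (≈.sym πΩ∘⟨⟩) ≈.refl ≈.refl !-unique₂ (χ-pullback m-regular)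

    open DependentProduct (dependentProduct lcc η f) public
      renaming (Π to F; π₁ to pF; π₂ to pB; pullback to P-pullback)

    transpose : ∀ {C} {m : Hom A C} {α : Hom C B} (m-regular : IsRegularMono 𝒞 m) → α ∘ m ≈ f →
      ∃!Hom 𝒞 (Transposes ⟨ χ m-regular , α ⟩ m f id)
    transpose {m = m} m-regular α∘m≈f =
      universal _ m f (classifying-square m-regular α∘m≈f) id identityʳ

    private
      f'-transpose : ∃!Hom 𝒞 (Transposes ⟨ χ id-regularMono , f ⟩ id f id)
      f'-transpose = transpose id-regularMono identityʳ

    f' : Hom A F
    f' = proj₁ f'-transpose

    f'' : Hom F B
    f'' = πB ∘ q

    q∘f' : q ∘ f' ≈ η ∘ f
    q∘f' = ≈.sym identityʳ ○ proj₁ (proj₁ (proj₂ f'-transpose)) ⟩∘⟨refl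
           ○ proj₁ (classifying-square id-regularMono identityʳ)

    f''∘f' : f'' ∘ f' ≈ f
    f''∘f' = pullʳ q∘f' ○ pullˡ πB∘⟨⟩ ○ identityˡ

    private
      toP-universal : ∃!Hom 𝒞 (λ w → (pF ∘ w ≈ f') × (pB ∘ w ≈ f))
      toP-universal = proj₂ P-pullback f' f q∘f'

    toP : Hom A P
    toP = proj₁ toP-universal

    pF∘toP : pF ∘ toP ≈ f'
    pF∘toP = proj₁ (proj₁ (proj₂ toP-universal))

    pB∘toP : pB ∘ toP ≈ f
    pB∘toP = proj₂ (proj₁ (proj₂ toP-universal))

    ev∘toP : ev ∘ toP ≈ id
    ev∘toP = proj₂ (proj₁ (proj₂ f'-transpose)) toP (pF∘toP ○ ≈.sym identityʳ) pB∘toP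

    ev-retraction : ∀ {Z} {w : Hom Z P} {x : Hom Z A} →
      pF ∘ w ≈ f' ∘ x → pB ∘ w ≈ f ∘ x → ev ∘ w ≈ x
    ev-retraction e₁ e₂ =
      refl⟩∘⟨ pullback-jointly-monic P-pullback
                (e₁ ○ ≈.sym (pullˡ pF∘toP)) (e₂ ○ ≈.sym (pullˡ pB∘toP))
      ○ pullˡ ev∘toP ○ identityˡ

    -- Both f' ∘ ev and pF transpose ev along the pullback square (q ∘ pF) ∘ id = η ∘ pB.
    f'∘ev : f' ∘ ev ≈ pF
    f'∘ev =
      let pb = mono⇒pullback-id (regularMono⇒mono η-regularMono) (proj₁ P-pullback)
          (_ , _ , unique) = universal (q ∘ pF) id pB pb ev ev-over
      in unique (f' ∘ ev)
           ( pullˡ q∘f' ○ pullʳ ev-over ○ ≈.sym (proj₁ P-pullback)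
           , λ w e₁ e₂ → ev-retraction (e₁ ○ identityʳ) (e₂ ○ ≈.sym ev-over) )
         ○ ≈.sym (unique pF
           ( ≈.refl
           , λ w e₁ e₂ →
               refl⟩∘⟨ pullback-jointly-monic P-pullback e₁ (e₂ ○ ≈.sym identityʳ) ○ identityʳ ))

    toP-iso : IsIso 𝒞 toP
    toP-iso = ev , ev∘toP , pullback-jointly-monic P-pullback
      (pullˡ pF∘toP ○ f'∘ev ○ ≈.sym identityʳ) (pullˡ pB∘toP ○ ev-over ○ ≈.sym identityʳ)

    f'-pullback : IsPullback 𝒞 q η f' f
    f'-pullback = pullback-resp-≈ ≈.refl ≈.refl pF∘toP pB∘toP (pullback-∘-iso toP-iso P-pullback)

    f'-regularMono : IsRegularMono 𝒞 f'
    f'-regularMono = pullback-of-regularMono η-regularMono f'-pullback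

    f'-classified : IsPullback 𝒞 (πΩ ∘ q) true f' (! A)
    f'-classified =
      pullback-resp-≈ ≈.refl ≈.refl ≈.refl !-unique₂ (pullback-glue f'-pullback η-pullback)

    materializes : ∀ {C} (m : Hom A C) (α : Hom C B) → IsRegularMono 𝒞 m → α ∘ m ≈ f →
      ∃!Hom 𝒞 (λ β → (f'' ∘ β ≈ α) × IsPullback 𝒞 β f' m id)
    materializes m α m-regular α∘m≈f = β , (f''∘β , β-pullback) , β-unique
      where
      β : Hom _ F
      β = proj₁ (transpose m-regular α∘m≈f)

      q∘β : q ∘ β ≈ ⟨ χ m-regular , α ⟩
      q∘β = proj₁ (proj₁ (proj₂ (transpose m-regular α∘m≈f)))

      f''∘β : f'' ∘ β ≈ α
      f''∘β = pullʳ q∘β ○ πB∘⟨⟩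

      β∘m : β ∘ m ≈ f'
      β∘m =
        let (t , (t₁ , t₂) , _) = proj₂ P-pullback (β ∘ m) f
                                    (pullˡ q∘β ○ proj₁ (classifying-square m-regular α∘m≈f))
            ev∘t≈id = proj₂ (proj₁ (proj₂ (transpose m-regular α∘m≈f))) t t₁ t₂
        in ≈.sym t₁ ○ ≈.sym f'∘ev ⟩∘⟨refl ○ pullʳ ev∘t≈id ○ identityʳ

      β-pullback : IsPullback 𝒞 β f' m id
      β-pullback = pullback-unglue (β∘m ○ ≈.sym identityʳ)
        (pullback-resp-≈ (≈.sym (pullʳ q∘β ○ πΩ∘⟨⟩)) ≈.refl ≈.refl !-unique₂ (χ-pullback m-regular))
        f'-classified

      β-unique : ∀ β' → (f'' ∘ β' ≈ α) × IsPullback 𝒞 β' f' m id → β' ≈ β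
      β-unique β' (f''∘β'≈α , β'-pullback) = proj₂ (proj₂ (transpose m-regular α∘m≈f)) β'
        ( ⟨⟩-jointly-monic (sym-assoc ○ χ-unique m-regular classified ○ ≈.sym πΩ∘⟨⟩)
                           (sym-assoc ○ f''∘β'≈α ○ ≈.sym πB∘⟨⟩)
        , λ w e₁ e₂ → ev-retraction (e₁ ○ proj₁ β'-pullback) (e₂ ○ ≈.sym identityʳ) )
        where
        classified : IsPullback 𝒞 ((πΩ ∘ q) ∘ β') true m (! A)
        classified = pullback-resp-≈ ≈.refl ≈.refl ≈.refl !-unique₂
          (pullback-glue β'-pullback f'-classified)

  rmMaterialization : ∀ {A B} (f : Hom A B) → RmMaterialization f
  rmMaterialization f = F , f' , f'' , f''∘f' , f'-regularMono , materializes
    where open Materialization f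

module Compaction {o ℓ e : Level} (𝒞 : Category o ℓ e) (ρ : PBPORule 𝒞) where
  open Category 𝒞
  open CategoryProperties 𝒞
  open PBPORule ρ

  module IdentityCompaction (pullbacks : HasPullbacks) (materialization : RmMaterialization tL)
                            (left-pullback : IsPullback 𝒞 tL l' l tK) where
    F : Obj
    F = proj₁ materialization

    f' : Hom L F
    f' = proj₁ (proj₂ materialization)

    f'' : Hom F L'
    f'' = proj₁ (proj₂ (proj₂ materialization))

    isMaterialization : IsRmMaterialization 𝒞 tL f' f''
    isMaterialization = proj₂ (proj₂ (proj₂ materialization))

    f''∘f' : f'' ∘ f' ≈ tL
    f''∘f' = proj₁ isMaterialization

    F' : Obj
    F' = proj₁ (pullbacks f'' l')

    p : Hom F' F
    p = proj₁ (proj₂ (pullbacks f'' l'))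

    q : Hom F' K'
    q = proj₁ (proj₂ (proj₂ (pullbacks f'' l')))

    F'-pullback : IsPullback 𝒞 f'' l' p q
    F'-pullback = proj₂ (proj₂ (proj₂ (pullbacks f'' l')))

    private
      h-universal : ∃!Hom 𝒞 (λ h → (p ∘ h ≈ f' ∘ l) × (q ∘ h ≈ tK))
      h-universal = proj₂ F'-pullback (f' ∘ l) tK (pullˡ f''∘f' ○ commL)

    h : Hom K F'
    h = proj₁ h-universal

    p∘h : p ∘ h ≈ f' ∘ l
    p∘h = proj₁ (proj₁ (proj₂ h-universal))

    q∘h : q ∘ h ≈ tK
    q∘h = proj₂ (proj₁ (proj₂ h-universal))

    K-pullback : IsPullback 𝒞 f' p l h
    K-pullback = pullback-unglue (≈.sym p∘h)
      (pullback-resp-≈ (≈.sym f''∘f') ≈.refl ≈.refl (≈.sym q∘h) left-pullback) F'-pullback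

    compaction : CompactionData 𝒞 ρ
    compaction = record
      { Le = L ; eL = id ; f = tL ; fact = ≈.sym identityʳ
      ; F = F ; f' = f' ; f'' = f'' ; rm = isMaterialization
      ; F' = F' ; p = p ; q = q ; pb₁ = F'-pullback
      ; Ke = K ; le = l ; k = h ; pb₂ = K-pullback
      ; h = h ; h-p = p∘h ○ refl⟩∘⟨ ≈.sym identityˡ ; h-q = q∘h
      ; j = id ; j-le = identityʳ ○ ≈.sym identityˡ ; j-k = identityʳ
      ; Re = R ; re = r ; wRe = id ; po = id-pushout }

    compaction-≅ : InCompact≅ 𝒞 ρ compaction
    compaction-≅ = id , identityˡ , identityˡ

    compact-step : ∀ {GL GR} → PBPO↪Step 𝒞 ρ GL GR → PBPO⁺Step 𝒞 (compactRule 𝒞 compaction) GL GR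
    compact-step
      (m , α , GK , gL , u' , u , gR , wR , m-regular , tL≈α∘m , α-pullback , gL∘u , u'∘u , po) =
      m , β , GK , gL , w , u , gR , wR ,
      (β∘m , pullback-swap β-pullback , w-pullback , (w∘u≈h , u-unique) , po)
      where
      β-universal : ∃!Hom 𝒞 (λ β → (f'' ∘ β ≈ α) × IsPullback 𝒞 β f' m id)
      β-universal = proj₂ (proj₂ isMaterialization) m α m-regular (≈.sym tL≈α∘m)

      β : Hom _ F
      β = proj₁ β-universal

      f''∘β : f'' ∘ β ≈ α
      f''∘β = proj₁ (proj₁ (proj₂ β-universal))

      β-pullback : IsPullback 𝒞 β f' m id
      β-pullback = proj₂ (proj₁ (proj₂ β-universal))

      β∘m : β ∘ m ≈ f'
      β∘m = proj₁ β-pullback ○ identityʳ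

      w-universal : ∃!Hom 𝒞 (λ w → (p ∘ w ≈ β ∘ gL) × (q ∘ w ≈ u'))
      w-universal = proj₂ F'-pullback (β ∘ gL) u' (pullˡ f''∘β ○ proj₁ α-pullback)

      w : Hom GK F'
      w = proj₁ w-universal

      p∘w : p ∘ w ≈ β ∘ gL
      p∘w = proj₁ (proj₁ (proj₂ w-universal))

      q∘w : q ∘ w ≈ u'
      q∘w = proj₂ (proj₁ (proj₂ w-universal))

      w-pullback : IsPullback 𝒞 β p gL w
      w-pullback = pullback-unglue (≈.sym p∘w)
        (pullback-resp-≈ (≈.sym f''∘β) ≈.refl ≈.refl (≈.sym q∘w) α-pullback) F'-pullback

      w∘u≈h : w ∘ u ≈ h
      w∘u≈h = pullback-jointly-monic F'-pullback
        (pullˡ p∘w ○ assoc ○ refl⟩∘⟨ gL∘u ○ sym-assoc ○ β∘m ⟩∘⟨refl ○ ≈.sym p∘h)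
        (pullˡ q∘w ○ u'∘u ○ ≈.sym q∘h)

      u-unique : ∀ v → w ∘ v ≈ h → v ≈ u
      u-unique v w∘v≈h = pullback-jointly-monic α-pullback gL∘v≈gL∘u
        (≈.sym q∘w ⟩∘⟨refl ○ assoc ○ refl⟩∘⟨ w∘v≈h ○ q∘h ○ ≈.sym u'∘u)
        where
        gL∘v≈gL∘u : gL ∘ v ≈ gL ∘ u
        gL∘v≈gL∘u = pullback-id-factor β-pullback
          (sym-assoc ○ ≈.sym p∘w ⟩∘⟨refl ○ assoc ○ refl⟩∘⟨ w∘v≈h ○ p∘h)
          ○ ≈.sym gL∘u

  decompact-step : (c : CompactionData 𝒞 ρ) → InCompact≅ 𝒞 ρ c →
    ∀ {GL GR} → PBPO⁺Step 𝒞 (compactRule 𝒞 c) GL GR → PBPO↪Step 𝒞 ρ GL GR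
  decompact-step c eL-iso
    (m' , α' , GK , gL , u'' , u , gR , wR , _ , m'-pullback , α'-pullback , (u''∘u , _) , po⁺) =
    m' ∘ eL , f'' ∘ α' , GK , gL , q ∘ u'' , u ∘ j , gR , wR ∘ wRe ,
    ( regularMono-∘-iso (pullback-of-regularMono f'-regular (pullback-swap m'-pullback)) eL-iso
    , tL-factor
    , pullback-glue α'-pullback pb₁
    , sym-assoc ○ gL∘u ⟩∘⟨refl ○ assoc ○ refl⟩∘⟨ j-le ○ sym-assoc
    , pullʳ (sym-assoc ○ u''∘u ⟩∘⟨refl ○ j-k) ○ h-q
    , pushout-glue po po⁺ )
    where
    open CompactionData c

    f'-regular : IsRegularMono 𝒞 f'
    f'-regular = proj₁ (proj₂ rm)

    α'∘m' : α' ∘ m' ≈ f'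
    α'∘m' = ≈.sym (proj₁ m'-pullback) ○ identityʳ

    tL-factor : tL ≈ (f'' ∘ α') ∘ (m' ∘ eL)
    tL-factor = fact ○ (≈.sym (proj₁ rm) ○ refl⟩∘⟨ ≈.sym α'∘m' ○ sym-assoc) ⟩∘⟨refl ○ assoc

    gL∘u : gL ∘ u ≈ m' ∘ le
    gL∘u = pullback-id-factor (pullback-swap m'-pullback)
      (sym-assoc ○ proj₁ α'-pullback ⟩∘⟨refl ○ pullʳ u''∘u ○ ≈.sym (proj₁ pb₂))

proposition14 : ∀ {o m e : Level} (𝒞 : Category o m e) → IsQuasitopos 𝒞 →
    (ρ : PBPORule 𝒞) → IsCanonical 𝒞 ρ →
    ∀ (GL GR : Category.Obj 𝒞) →
      PBPO↪Step 𝒞 ρ GL GR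
        ⇔ (Σ[ c ∈ CompactionData 𝒞 ρ ] (InCompact≅ 𝒞 ρ c × PBPO⁺Step 𝒞 (compactRule 𝒞 c) GL GR))
proposition14 𝒞 QT ρ (left-pullback , _) GL GR = mk⇔
  (λ step → compaction , compaction-≅ , compact-step step)
  (λ (c , c-≅ , step) → decompact-step c c-≅ step)
  where
  open Compaction 𝒞 ρ
  open IdentityCompaction (IsQuasitopos.pullback QT)
    (QuasitoposMaterialization.rmMaterialization 𝒞 QT (PBPORule.tL ρ)) left-pullback
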